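{- Let $G=(V,E)$ be a finite simple undirected graph, let $\mathcal{G}=(\mathcal{V},\mathcal{E})$ be a lossless summary of $G$, and let $u,v\in V$ be distinct nodes with $S(u)=S(v)$, where $S(x)$ denotes the supernode containing $x$. Let $d(u,v)$ denote the length of a shortest path between $u$ and $v$ in $G$ ($d(u,v)=\infty$ if none exists). Then: (1) if $S(u)$ is a clique supernode, $d(u,v)=1$; (2) if $S(u)$ is an independent set supernode and $|N(S(u))|>0$, then $d(u,v)=2$, and otherwise $d(u,v)=\infty$.
   Context: A summary of $G$ is a pair $(\mathcal{V},\mathcal{E})$ where $\mathcal{V}$ is a partition of $V$ into nonempty sets (supernodes) and $\mathcal{E}$ a set of unordered pairs $\{S_i,S_j\}$ of supernodes ($i=j$ allowed, a self-loop), called superedges. Its reconstruction is the simple graph on $V$ containing, for each superedge $\{S_i,S_j\}$ with $i\neq j$, all pairs $\{x,y\}$ with $x\in S_i, y\in S_j$, and for each self-loop $\{S_i,S_i\}$, all pairs of distinct nodes of $S_i$. The summary is lossless if its reconstruction equals $G$. A supernode of size at least two is a clique supernode if it carries a self-loop and an independent set supernode otherwise. $N(X)$ denotes the set of supernodes $Y\neq X$ such that $\{X,Y\}\in\mathcal{E}$. -}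

module Defs where

open import Data.Nat using (ℕ; zero; suc; _<_)
open import Data.Fin using (Fin)
open import Data.Maybe using (Maybe; just; nothing)
open import Data.Product using (Σ; ∃; ∃-syntax; _×_; _,_)
open import Relation.Nullary using (¬_)
open import Relation.Binary.PropositionalEquality using (_≡_; _≢_)
open import Function.Bundles using (_⇔_)

record Graph (n : ℕ) : Set₁ where
  field
    Adj     : Fin n → Fin n → Set
    sym     : ∀ {x y} → Adj x y → Adj y x
    irrefl  : ∀ {x} → ¬ Adj x x
open Graph public

-- A summary: a partition of V = Fin n into k nonempty supernodes, given by
-- the map S assigning each node its supernode (surjective = every supernode
-- nonempty), together with a set of unordered pairs of supernodes
-- (self-loops allowed), encoded as a symmetric relation.
record Summary (n : ℕ) : Set₁ where
  field
    k         : ℕ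
    S         : Fin n → Fin k
    nonempty  : ∀ (X : Fin k) → ∃[ x ] S x ≡ X
    SuperEdge : Fin k → Fin k → Set
    superSym  : ∀ {X Y} → SuperEdge X Y → SuperEdge Y X
open Summary public

-- Reconstruction: {x,y} is an edge iff x ≠ y and {S x, S y} is a superedge
-- (covers both the i ≠ j case and the self-loop case).
Reconstruction : ∀ {n} → Summary n → Fin n → Fin n → Set
Reconstruction 𝒢 x y = (x ≢ y) × SuperEdge 𝒢 (S 𝒢 x) (S 𝒢 y)

Lossless : ∀ {n} → Graph n → Summary n → Set
Lossless G 𝒢 = ∀ x y → Adj G x y ⇔ Reconstruction 𝒢 x y

SizeAtLeast2 : ∀ {n} (𝒢 : Summary n) → Fin (k 𝒢) → Set
SizeAtLeast2 𝒢 X = ∃[ x ] ∃[ y ] (x ≢ y × S 𝒢 x ≡ X × S 𝒢 y ≡ X)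

CliqueSupernode : ∀ {n} (𝒢 : Summary n) → Fin (k 𝒢) → Set
CliqueSupernode 𝒢 X = SizeAtLeast2 𝒢 X × SuperEdge 𝒢 X X

IndependentSetSupernode : ∀ {n} (𝒢 : Summary n) → Fin (k 𝒢) → Set
IndependentSetSupernode 𝒢 X = SizeAtLeast2 𝒢 X × ¬ SuperEdge 𝒢 X X

InN : ∀ {n} (𝒢 : Summary n) → Fin (k 𝒢) → Fin (k 𝒢) → Set
InN 𝒢 X Y = (Y ≢ X) × SuperEdge 𝒢 X Y

NNonempty : ∀ {n} (𝒢 : Summary n) → Fin (k 𝒢) → Set
NNonempty 𝒢 X = ∃[ Y ] InN 𝒢 X Y

data Path {n} (G : Graph n) : Fin n → Fin n → ℕ → Set where
  here : ∀ {x} → Path G x x zero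
  step : ∀ {x y z ℓ} → Adj G x y → Path G y z ℓ → Path G x z (suc ℓ)

ℕ∞ : Set
ℕ∞ = Maybe ℕ

Dist : ∀ {n} → Graph n → Fin n → Fin n → ℕ∞ → Set
Dist G u v (just d) = Path G u v d × (∀ m → m < d → ¬ Path G u v m)
Dist G u v nothing  = ∀ m → ¬ Path G u v m

module Submission where

open import Defs
open import Data.Nat using (zero; suc; s≤s)
open import Data.Fin using (Fin)
open import Data.Fin.Properties using (_≟_)
open import Data.Maybe using (just; nothing)
open import Data.Product using (_×_; _,_; proj₂; curry)
open import Function using (_∘_)
open import Function.Bundles using (Equivalence)
open import Relation.Nullary using (¬_; yes; no)
open import Relation.Binary.PropositionalEquality using (_≡_; _≢_; refl; trans; subst)
  renaming (sym to ≡-sym)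

-- In a lossless summary, adjacency of distinct nodes depends only on their
-- supernodes.  Two nodes of a clique supernode are therefore adjacent; two
-- nodes of an independent set supernode are not, but both are adjacent to
-- every node of any neighbouring supernode, and if there is none, neither
-- node has any neighbour at all.

module _ {n} {G : Graph n} where

  path0⇒≡ : ∀ {x y} → Path G x y 0 → x ≡ y
  path0⇒≡ here = refl

  path1⇒adj : ∀ {x y} → Path G x y 1 → Adj G x y
  path1⇒adj (step a here) = a

  dist-adjacent : ∀ {x y} → x ≢ y → Adj G x y → Dist G x y (just 1)
  dist-adjacent x≢y a = step a here , λ
    { zero    _             → x≢y ∘ path0⇒≡
    ; (suc _) (s≤s ())
    }

  dist-commonNeighbour : ∀ {x y w} → x ≢ y → ¬ Adj G x y
                       → Adj G x w → Adj G w y → Dist G x y (just 2)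
  dist-commonNeighbour x≢y ¬xy xw wy = step xw (step wy here) , λ
    { zero          _                  → x≢y ∘ path0⇒≡
    ; (suc zero)    _                  → ¬xy ∘ path1⇒adj
    ; (suc (suc _)) (s≤s (s≤s ()))
    }

  dist-isolated : ∀ {x y} → x ≢ y → (∀ w → ¬ Adj G x w) → Dist G x y nothing
  dist-isolated x≢y _        zero    p          = x≢y (path0⇒≡ p)
  dist-isolated _   isolated (suc _) (step a _) = isolated _ a

module LosslessProperties
  {n} {G : Graph n} {𝒢 : Summary n} (lossless : Lossless G 𝒢) where

  open Equivalence

  adj⇒superEdge : ∀ {x y} → Adj G x y → SuperEdge 𝒢 (S 𝒢 x) (S 𝒢 y)
  adj⇒superEdge {x} {y} = proj₂ ∘ to (lossless x y)

  superEdge⇒adj : ∀ {x y X Y} → S 𝒢 x ≡ X → S 𝒢 y ≡ Y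
                → x ≢ y → SuperEdge 𝒢 X Y → Adj G x y
  superEdge⇒adj {x} {y} refl refl = curry (from (lossless x y))

  superEdge⇒adj-across : ∀ {x y X Y} → S 𝒢 x ≡ X → S 𝒢 y ≡ Y
                       → X ≢ Y → SuperEdge 𝒢 X Y → Adj G x y
  superEdge⇒adj-across Sx≡X Sy≡Y X≢Y =
    superEdge⇒adj Sx≡X Sy≡Y λ { refl → X≢Y (trans (≡-sym Sx≡X) Sy≡Y) }

  noSelfLoop⇒¬adj : ∀ {x y} → S 𝒢 x ≡ S 𝒢 y → ¬ SuperEdge 𝒢 (S 𝒢 x) (S 𝒢 x)
                  → ¬ Adj G x y
  noSelfLoop⇒¬adj {x} Sx≡Sy noLoop a =
    noLoop (subst (SuperEdge 𝒢 (S 𝒢 x)) (≡-sym Sx≡Sy) (adj⇒superEdge a))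

  isolatedSupernode⇒¬adj : ∀ {x y} → ¬ SuperEdge 𝒢 (S 𝒢 x) (S 𝒢 x)
                         → ¬ NNonempty 𝒢 (S 𝒢 x) → ¬ Adj G x y
  isolatedSupernode⇒¬adj {x} {y} noLoop noNeighbour a with S 𝒢 y ≟ S 𝒢 x
  ... | yes Sy≡Sx = noLoop (subst (SuperEdge 𝒢 (S 𝒢 x)) Sy≡Sx (adj⇒superEdge a))
  ... | no Sy≢Sx  = noNeighbour (S 𝒢 y , Sy≢Sx , adj⇒superEdge a)

theorem3p6 : ∀ {n} (G : Graph n) (𝒢 : Summary n) → Lossless G 𝒢
    → (u v : Fin n) → u ≢ v → S 𝒢 u ≡ S 𝒢 v
    → (CliqueSupernode 𝒢 (S 𝒢 u) → Dist G u v (just 1))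
      × (IndependentSetSupernode 𝒢 (S 𝒢 u)
          → (NNonempty 𝒢 (S 𝒢 u) → Dist G u v (just 2))
            × (¬ NNonempty 𝒢 (S 𝒢 u) → Dist G u v nothing))
theorem3p6 G 𝒢 lossless u v u≢v Su≡Sv = clique , independentSet
  where
  open LosslessProperties {G = G} {𝒢 = 𝒢} lossless

  clique : CliqueSupernode 𝒢 (S 𝒢 u) → Dist G u v (just 1)
  clique (_ , loop) =
    dist-adjacent u≢v (superEdge⇒adj refl (≡-sym Su≡Sv) u≢v loop)

  independentSet : IndependentSetSupernode 𝒢 (S 𝒢 u)
                 → (NNonempty 𝒢 (S 𝒢 u) → Dist G u v (just 2))
                   × (¬ NNonempty 𝒢 (S 𝒢 u) → Dist G u v nothing)
  independentSet (_ , noLoop) = reachable , unreachable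
    where
    reachable : NNonempty 𝒢 (S 𝒢 u) → Dist G u v (just 2)
    reachable (Y , Y≢Su , edge) =
      let w , Sw≡Y = nonempty 𝒢 Y in
      dist-commonNeighbour u≢v (noSelfLoop⇒¬adj Su≡Sv noLoop)
        (superEdge⇒adj-across refl Sw≡Y (Y≢Su ∘ ≡-sym) edge)
        (superEdge⇒adj-across Sw≡Y (≡-sym Su≡Sv) Y≢Su (superSym 𝒢 edge))

    unreachable : ¬ NNonempty 𝒢 (S 𝒢 u) → Dist G u v nothing
    unreachable noNeighbour =
      dist-isolated u≢v (λ _ → isolatedSupernode⇒¬adj noLoop noNeighbour)
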